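{- Let $k$ be an integer and let $G$ be a bipartite graph with bipartition $(X,Y)$ such that $|Y|\ge 2|X|-k$ and $d_G(y)\ge 3$ for all $y\in Y$. Suppose $\{A,B\}$ is a $2$-separation of $G$, and let $S=Y\cap V(A)\cap V(B)$. Then there is $G'\in\{A-S,\,B-S\}$ such that, writing $X'=X\cap V(G')$ and $Y'=Y\cap V(G')$ (so $G'$ is bipartite with bipartition $(X',Y')$), we have $|X'|<|X|$ and $|Y'|\ge 2|X'|-\lfloor \frac{k+4}{2}\rfloor$. Moreover, $d_G(y)=d_{G'}(y)$ for all $y\in Y'$.
   Context: All graphs are finite and simple. A $2$-separation of $G$ is a pair $\{G_1,G_2\}$ of edge-disjoint subgraphs with $G_1\cup G_2=G$, $|V(G_1)\cap V(G_2)|=2$, and $\min\{|V(G_1)|,|V(G_2)|\}\ge 3$ (isolated vertices are allowed in $G_1,G_2$). $A-S$ denotes deletion of the vertex set $S$ from $A$. -}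

module Defs where

open import Data.Nat using (ℕ; _≤_; _<_)
open import Data.Bool using (Bool; true; false; _∧_; not)
open import Data.Fin using (Fin)
open import Data.Fin.Subset using (Subset; _∈_; _∉_; _∩_; ∁; ∣_∣)
open import Data.Vec using (tabulate; lookup)
open import Data.Product using (_×_)
open import Data.Sum using (_⊎_)
open import Data.Integer as ℤ using (ℤ; +_)
open import Data.Integer.DivMod using (_/ℕ_)
open import Relation.Binary.PropositionalEquality using (_≡_)

record Graph (n : ℕ) : Set where
  field
    adj    : Fin n → Fin n → Bool
    sym    : ∀ u v → adj u v ≡ adj v u
    irrefl : ∀ v → adj v v ≡ false
open Graph public

record Subgraph {n : ℕ} (G : Graph n) : Set where
  field
    verts  : Subset n
    edges  : Fin n → Fin n → Bool
    esym   : ∀ u v → edges u v ≡ edges v u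
    e⊆adj  : ∀ u v → edges u v ≡ true → adj G u v ≡ true
    e-ends : ∀ u v → edges u v ≡ true → (u ∈ verts × v ∈ verts)
open Subgraph public

degE : {n : ℕ} → (Fin n → Fin n → Bool) → Fin n → ℕ
degE E u = ∣ tabulate (E u) ∣

deg : {n : ℕ} → Graph n → Fin n → ℕ
deg G = degE (adj G)

IsBipartition : {n : ℕ} → Graph n → Subset n → Subset n → Set
IsBipartition {n} G X Y =
  (∀ v → (v ∈ X × v ∉ Y) ⊎ (v ∉ X × v ∈ Y)) ×
  (∀ u v → adj G u v ≡ true → (u ∈ X × v ∈ Y) ⊎ (u ∈ Y × v ∈ X))

IsTwoSeparation : {n : ℕ} (G : Graph n) → Subgraph G → Subgraph G → Set
IsTwoSeparation {n} G A B =
  (∀ u v → edges A u v ≡ true → edges B u v ≡ false) ×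
  (∀ v → v ∈ verts A ⊎ v ∈ verts B) ×
  (∀ u v → adj G u v ≡ true → edges A u v ≡ true ⊎ edges B u v ≡ true) ×
  (∣ verts A ∩ verts B ∣ ≡ 2) ×
  (3 ≤ ∣ verts A ∣) × (3 ≤ ∣ verts B ∣)

delVerts : {n : ℕ} → Subset n → Subset n → Subset n
delVerts V S = V ∩ ∁ S

delEdges : {n : ℕ} → (Fin n → Fin n → Bool) → Subset n → Fin n → Fin n → Bool
delEdges E S u v = E u v ∧ not (lookup S u) ∧ not (lookup S v)

GoodSide : {n : ℕ} (G : Graph n) (X Y : Subset n) (k : ℤ) (H : Subgraph G) (S : Subset n) → Set
GoodSide G X Y k H S =
  let V' = delVerts (verts H) S
      E' = delEdges (edges H) S
      X' = X ∩ V'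
      Y' = Y ∩ V'
  in (∣ X' ∣ < ∣ X ∣) ×
     ((+ ∣ Y' ∣) ℤ.≥ ((+ 2) ℤ.* (+ ∣ X' ∣) ℤ.- ((k ℤ.+ + 4) /ℕ 2))) ×
     (∀ y → y ∈ Y' → deg G y ≡ degE E' y)

{-# OPTIONS --safe #-}
-- Let t = |X ∩ A ∩ B| and s = |S|; then s + t = |A ∩ B| = 2.  On the A-side X′ = X ∩ A,
-- so the X′ of the two sides have sizes summing to at most |X| + t, while the two Y′
-- together with S cover Y.  If both sides violated the density bound, adding the two
-- violations to |Y| ≥ 2|X| − k and using 2⌊(k+4)/2⌋ ≥ k + 3 would force t ≥ 3.
-- Each side misses an X-vertex: otherwise a vertex of the other side outside A ∩ B would
-- be a Y-vertex with all its ≥ 3 neighbours in A ∩ B.  A Y-vertex of G′ is outside the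
-- other side, so all its edges belong to G′, and their other ends lie in X, hence outside S.
module Submission where

open import Data.Bool using (true; false)
open import Data.Empty using (⊥-elim)
open import Data.Fin.Properties using (any?)
open import Data.Fin.Subset using (Subset; _∈_; _∉_; _⊆_; _∩_; _∪_; ∣_∣; ⊥; inside; outside)
open import Data.Fin.Subset.Properties
  using (_∈?_; p⊆q⇒∣p∣≤∣q∣; p⊂q⇒∣p∣<∣q∣; x∈p∩q⁺; x∈p∩q⁻; x∈p∪q⁺; x∈p∪q⁻; x∉p⇒x∈∁p; x∈∁p⇒x∉p; ∩-comm; ∣⊥∣≡0)
open import Data.Integer as ℤ using (ℤ; +_)
open import Data.Integer.DivMod using (_/ℕ_; _%ℕ_; a≡a%ℕn+[a/ℕn]*n; n%ℕd<d)
import Data.Integer.Properties as ℤ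
open import Data.Integer.Tactic.RingSolver using (solve-∀)
open import Data.Nat as ℕ using (ℕ; suc; _+_; _≤_; _<_)
import Data.Nat.Properties as ℕ
open import Data.Product using (∃; _×_; _,_; proj₁; proj₂)
open import Data.Sum using (_⊎_; inj₁; inj₂)
import Data.Sum as Sum
open import Data.Vec using (_∷_; []; tabulate; lookup)
open import Data.Vec.Properties using (tabulate-cong; lookup∘tabulate; []=⇒lookup; lookup⇒[]=)
open import Function using (_∘_)
open import Relation.Binary.PropositionalEquality as ≡ using (_≡_; refl; cong; cong₂; subst)
open import Relation.Nullary using (yes; no; ¬?)
open import Relation.Nullary.Decidable using (decidable-stable; _×-dec_)

open import Defs

∣p∪q∣+∣p∩q∣≡∣p∣+∣q∣ : ∀ {n} (p q : Subset n) → ∣ p ∪ q ∣ + ∣ p ∩ q ∣ ≡ ∣ p ∣ + ∣ q ∣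
∣p∪q∣+∣p∩q∣≡∣p∣+∣q∣ []            []            = refl
∣p∪q∣+∣p∩q∣≡∣p∣+∣q∣ (inside  ∷ p) (inside  ∷ q) =
  cong suc (≡.trans (ℕ.+-suc _ _) (≡.trans (cong suc (∣p∪q∣+∣p∩q∣≡∣p∣+∣q∣ p q)) (≡.sym (ℕ.+-suc _ _))))
∣p∪q∣+∣p∩q∣≡∣p∣+∣q∣ (inside  ∷ p) (outside ∷ q) = cong suc (∣p∪q∣+∣p∩q∣≡∣p∣+∣q∣ p q)
∣p∪q∣+∣p∩q∣≡∣p∣+∣q∣ (outside ∷ p) (inside  ∷ q) =
  ≡.trans (cong suc (∣p∪q∣+∣p∩q∣≡∣p∣+∣q∣ p q)) (≡.sym (ℕ.+-suc _ _))
∣p∪q∣+∣p∩q∣≡∣p∣+∣q∣ (outside ∷ p) (outside ∷ q) = ∣p∪q∣+∣p∩q∣≡∣p∣+∣q∣ p q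

∣p∪q∣≤∣p∣+∣q∣ : ∀ {n} (p q : Subset n) → ∣ p ∪ q ∣ ≤ ∣ p ∣ + ∣ q ∣
∣p∪q∣≤∣p∣+∣q∣ p q = subst (∣ p ∪ q ∣ ≤_) (∣p∪q∣+∣p∩q∣≡∣p∣+∣q∣ p q) (ℕ.m≤m+n _ _)

∣p∣+∣q∣≤∣r∣+∣s∣ : ∀ {n} {p q r s : Subset n} → p ∪ q ⊆ r → p ∩ q ⊆ s → ∣ p ∣ + ∣ q ∣ ≤ ∣ r ∣ + ∣ s ∣
∣p∣+∣q∣≤∣r∣+∣s∣ {p = p} {q} {r} {s} p∪q⊆r p∩q⊆s =
  subst (_≤ ∣ r ∣ + ∣ s ∣) (∣p∪q∣+∣p∩q∣≡∣p∣+∣q∣ p q) (ℕ.+-mono-≤ (p⊆q⇒∣p∣≤∣q∣ p∪q⊆r) (p⊆q⇒∣p∣≤∣q∣ p∩q⊆s))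

∣p∣<∣q∣⇒∃∈q∉p : ∀ {n} {p q : Subset n} → ∣ p ∣ < ∣ q ∣ → ∃ λ v → v ∈ q × v ∉ p
∣p∣<∣q∣⇒∃∈q∉p {p = p} {q} ∣p∣<∣q∣ with any? (λ v → (v ∈? q) ×-dec ¬? (v ∈? p))
... | yes found = found
... | no  none  = ⊥-elim (ℕ.<⇒≱ ∣p∣<∣q∣ (p⊆q⇒∣p∣≤∣q∣ q⊆p))
  where
  q⊆p : q ⊆ p
  q⊆p {v} v∈q = decidable-stable (v ∈? p) (λ v∉p → none (v , v∈q , v∉p))

∉⇒lookup≡outside : ∀ {n} {p : Subset n} {v} → v ∉ p → lookup p v ≡ outside
∉⇒lookup≡outside {p = p} {v} v∉p with lookup p v in eq
... | inside  = ⊥-elim (v∉p (lookup⇒[]= v p eq))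
... | outside = refl

module Bipartition {n} {G : Graph n} {X Y : Subset n} (bip : IsBipartition G X Y) where

  ∈X⇒∉Y : ∀ {v} → v ∈ X → v ∉ Y
  ∈X⇒∉Y {v} v∈X with proj₁ bip v
  ... | inj₁ (_ , v∉Y) = v∉Y
  ... | inj₂ (v∉X , _) = ⊥-elim (v∉X v∈X)

  ∉X⇒∈Y : ∀ {v} → v ∉ X → v ∈ Y
  ∉X⇒∈Y {v} v∉X with proj₁ bip v
  ... | inj₁ (v∈X , _) = ⊥-elim (v∉X v∈X)
  ... | inj₂ (_ , v∈Y) = v∈Y

  ∈Y⇒nbr∈X : ∀ {u v} → u ∈ Y → adj G u v ≡ true → v ∈ X
  ∈Y⇒nbr∈X {u} {v} u∈Y e with proj₂ bip u v e
  ... | inj₁ (u∈X , _) = ⊥-elim (∈X⇒∉Y u∈X u∈Y)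
  ... | inj₂ (_ , v∈X) = v∈X

module _ {n} {G : Graph n} {A B : Subgraph G} where

  IsTwoSeparation-sym : IsTwoSeparation G A B → IsTwoSeparation G B A
  IsTwoSeparation-sym (disjoint , covers , covers-edges , ∣A∩B∣≡2 , 3≤∣A∣ , 3≤∣B∣) =
    disjoint-sym , (λ v → Sum.swap (covers v)) , (λ u v e → Sum.swap (covers-edges u v e)) ,
    ≡.trans (cong ∣_∣ (∩-comm (verts B) (verts A))) ∣A∩B∣≡2 , 3≤∣B∣ , 3≤∣A∣
    where
    disjoint-sym : ∀ u v → edges B u v ≡ true → edges A u v ≡ false
    disjoint-sym u v inB with edges A u v in inA
    ... | false = refl
    ... | true with ≡.trans (≡.sym inB) (disjoint u v inA)
    ...   | ()

  edge∉B⇒edge∈A : IsTwoSeparation G A B → ∀ {u v} → u ∉ verts B → adj G u v ≡ true → edges A u v ≡ true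
  edge∉B⇒edge∈A (_ , _ , covers-edges , _) {u} {v} u∉B e with covers-edges u v e
  ... | inj₁ inA = inA
  ... | inj₂ inB = ⊥-elim (u∉B (proj₁ (e-ends B u v inB)))

deg≡degE-delEdges : ∀ {n} {G : Graph n} (H : Subgraph G) (S : Subset n) {v} →
  (∀ {w} → adj G v w ≡ true → edges H v w ≡ true) → v ∉ S → (∀ {w} → adj G v w ≡ true → w ∉ S) →
  deg G v ≡ degE (delEdges (edges H) S) v
deg≡degE-delEdges {G = G} H S {v} edge∈H v∉S nbr∉S = cong ∣_∣ (tabulate-cong same-edge)
  where
  same-edge : ∀ w → adj G v w ≡ delEdges (edges H) S v w
  same-edge w with adj G v w in e
  ... | true rewrite edge∈H e | ∉⇒lookup≡outside v∉S | ∉⇒lookup≡outside (nbr∉S e) = refl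
  ... | false with edges H v w in h
  ...   | false = refl
  ...   | true with ≡.trans (≡.sym (e⊆adj H v w h)) e
  ...     | ()

module TwoSeparation {n} {G : Graph n} {X Y : Subset n} (bip : IsBipartition G X Y)
                     {A B : Subgraph G} (sep : IsTwoSeparation G A B) where
  open Bipartition {G = G} bip

  ∣A∩B∣≡2 : ∣ verts A ∩ verts B ∣ ≡ 2
  ∣A∩B∣≡2 = let (_ , _ , _ , two , _) = sep in two

  ∣A∩B∣<∣B∣ : ∣ verts A ∩ verts B ∣ < ∣ verts B ∣
  ∣A∩B∣<∣B∣ = let (_ , _ , _ , _ , _ , 3≤∣B∣) = sep in subst (_< ∣ verts B ∣) (≡.sym ∣A∩B∣≡2) 3≤∣B∣

  S X′ Y′ : Subset n
  S  = Y ∩ verts A ∩ verts B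
  X′ = X ∩ delVerts (verts A) S
  Y′ = Y ∩ delVerts (verts A) S

  ∈X′⁻ : ∀ {v} → v ∈ X′ → v ∈ X × v ∈ verts A
  ∈X′⁻ v∈X′ = let (v∈X , v∈A∖S) = x∈p∩q⁻ X _ v∈X′ in v∈X , proj₁ (x∈p∩q⁻ (verts A) _ v∈A∖S)

  ∈Y′⁺ : ∀ {v} → v ∈ Y → v ∈ verts A → v ∉ verts B → v ∈ Y′
  ∈Y′⁺ v∈Y v∈A v∉B =
    x∈p∩q⁺ (v∈Y , x∈p∩q⁺ (v∈A , x∉p⇒x∈∁p (λ v∈S → v∉B (proj₂ (x∈p∩q⁻ _ _ (proj₂ (x∈p∩q⁻ Y _ v∈S)))))))

  ∈Y′⁻ : ∀ {v} → v ∈ Y′ → v ∈ Y × v ∉ S × v ∉ verts B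
  ∈Y′⁻ v∈Y′ = v∈Y , v∉S , λ v∈B → v∉S (x∈p∩q⁺ (v∈Y , x∈p∩q⁺ (v∈A , v∈B)))
    where
    v∈Y = proj₁ (x∈p∩q⁻ Y _ v∈Y′)
    v∈A∖S = proj₂ (x∈p∩q⁻ Y _ v∈Y′)
    v∈A = proj₁ (x∈p∩q⁻ (verts A) _ v∈A∖S)
    v∉S = x∈∁p⇒x∉p (proj₂ (x∈p∩q⁻ (verts A) _ v∈A∖S))

  ∃∈X∉A : (∀ y → y ∈ Y → 3 ≤ deg G y) → ∃ λ w → w ∈ X × w ∉ verts A
  ∃∈X∉A deg≥3 with any? (λ w → (w ∈? X) ×-dec ¬? (w ∈? verts A))
  ... | yes found = found
  ... | no  none  with ∣p∣<∣q∣⇒∃∈q∉p ∣A∩B∣<∣B∣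
  ...   | v , v∈B , v∉A∩B =
    ⊥-elim (ℕ.<⇒≱ (deg≥3 v v∈Y) (subst (deg G v ≤_) ∣A∩B∣≡2 (p⊆q⇒∣p∣≤∣q∣ nbrs⊆A∩B)))
    where
    X⊆A : X ⊆ verts A
    X⊆A {w} w∈X = decidable-stable (w ∈? verts A) (λ w∉A → none (w , w∈X , w∉A))
    v∉A : v ∉ verts A
    v∉A v∈A = v∉A∩B (x∈p∩q⁺ (v∈A , v∈B))
    v∈Y : v ∈ Y
    v∈Y = ∉X⇒∈Y (λ v∈X → v∉A (X⊆A v∈X))
    nbrs⊆A∩B : tabulate (adj G v) ⊆ verts A ∩ verts B
    nbrs⊆A∩B {w} w∈nbrs = x∈p∩q⁺ (X⊆A (∈Y⇒nbr∈X v∈Y vw) , proj₂ (e-ends B v w vw∈B))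
      where
      vw : adj G v w ≡ true
      vw = ≡.trans (≡.sym (lookup∘tabulate (adj G v) w)) ([]=⇒lookup w∈nbrs)
      vw∈B : edges B v w ≡ true
      vw∈B = edge∉B⇒edge∈A {A = B} {A} (IsTwoSeparation-sym {A = A} {B} sep) v∉A vw

  ∣X′∣<∣X∣ : (∀ y → y ∈ Y → 3 ≤ deg G y) → ∣ X′ ∣ < ∣ X ∣
  ∣X′∣<∣X∣ deg≥3 = let (w , w∈X , w∉A) = ∃∈X∉A deg≥3 in
    p⊂q⇒∣p∣<∣q∣ ((λ v∈X′ → proj₁ (∈X′⁻ v∈X′)) , w , w∈X , λ w∈X′ → w∉A (proj₂ (∈X′⁻ w∈X′)))

  deg-Y′ : ∀ y → y ∈ Y′ → deg G y ≡ degE (delEdges (edges A) S) y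
  deg-Y′ y y∈Y′ = let (y∈Y , y∉S , y∉B) = ∈Y′⁻ y∈Y′ in
    deg≡degE-delEdges A S (edge∉B⇒edge∈A {A = A} {B} sep y∉B) y∉S
      (λ e w∈S → ∈X⇒∉Y (∈Y⇒nbr∈X y∈Y e) (proj₁ (x∈p∩q⁻ Y _ w∈S)))

  goodSide : (∀ y → y ∈ Y → 3 ≤ deg G y) → (k : ℤ) →
    (+ ∣ Y′ ∣) ℤ.≥ ((+ 2) ℤ.* (+ ∣ X′ ∣) ℤ.- ((k ℤ.+ + 4) /ℕ 2)) → GoodSide G X Y k A S
  goodSide deg≥3 k dense = ∣X′∣<∣X∣ deg≥3 , dense , deg-Y′

module BothSides {n} {G : Graph n} {X Y : Subset n} (bip : IsBipartition G X Y)
                 {A B : Subgraph G} (sep : IsTwoSeparation G A B) where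
  open Bipartition {G = G} bip
  module ᴬ = TwoSeparation {G = G} bip {A} {B} sep
  module ᴮ = TwoSeparation {G = G} bip {B} {A} (IsTwoSeparation-sym {A = A} {B} sep)

  ∣X′ᴬ∣+∣X′ᴮ∣≤∣X∣+∣X∩A∩B∣ : ∣ ᴬ.X′ ∣ + ∣ ᴮ.X′ ∣ ≤ ∣ X ∣ + ∣ X ∩ verts A ∩ verts B ∣
  ∣X′ᴬ∣+∣X′ᴮ∣≤∣X∣+∣X∩A∩B∣ = ∣p∣+∣q∣≤∣r∣+∣s∣ ∪⊆X ∩⊆X∩A∩B
    where
    ∪⊆X : ᴬ.X′ ∪ ᴮ.X′ ⊆ X
    ∪⊆X v∈ with x∈p∪q⁻ ᴬ.X′ ᴮ.X′ v∈
    ... | inj₁ v∈X′ᴬ = proj₁ (ᴬ.∈X′⁻ v∈X′ᴬ)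
    ... | inj₂ v∈X′ᴮ = proj₁ (ᴮ.∈X′⁻ v∈X′ᴮ)
    ∩⊆X∩A∩B : ᴬ.X′ ∩ ᴮ.X′ ⊆ X ∩ verts A ∩ verts B
    ∩⊆X∩A∩B v∈ = let (v∈X′ᴬ , v∈X′ᴮ) = x∈p∩q⁻ ᴬ.X′ ᴮ.X′ v∈
                     (v∈X , v∈A) = ᴬ.∈X′⁻ v∈X′ᴬ
                 in x∈p∩q⁺ (v∈X , x∈p∩q⁺ (v∈A , proj₂ (ᴮ.∈X′⁻ v∈X′ᴮ)))

  ∣Y∣≤∣Y′ᴬ∣+∣Y′ᴮ∣+∣S∣ : ∣ Y ∣ ≤ ∣ ᴬ.Y′ ∣ + ∣ ᴮ.Y′ ∣ + ∣ ᴬ.S ∣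
  ∣Y∣≤∣Y′ᴬ∣+∣Y′ᴮ∣+∣S∣ = begin
    ∣ Y ∣                              ≤⟨ p⊆q⇒∣p∣≤∣q∣ Y⊆ ⟩
    ∣ (ᴬ.Y′ ∪ ᴮ.Y′) ∪ ᴬ.S ∣            ≤⟨ ∣p∪q∣≤∣p∣+∣q∣ (ᴬ.Y′ ∪ ᴮ.Y′) ᴬ.S ⟩
    ∣ ᴬ.Y′ ∪ ᴮ.Y′ ∣ + ∣ ᴬ.S ∣          ≤⟨ ℕ.+-monoˡ-≤ ∣ ᴬ.S ∣ (∣p∪q∣≤∣p∣+∣q∣ ᴬ.Y′ ᴮ.Y′) ⟩
    ∣ ᴬ.Y′ ∣ + ∣ ᴮ.Y′ ∣ + ∣ ᴬ.S ∣      ∎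
    where
    open ℕ.≤-Reasoning
    Y⊆ : Y ⊆ (ᴬ.Y′ ∪ ᴮ.Y′) ∪ ᴬ.S
    Y⊆ {v} v∈Y with v ∈? verts A | v ∈? verts B
    ... | yes v∈A | yes v∈B = x∈p∪q⁺ (inj₂ (x∈p∩q⁺ (v∈Y , x∈p∩q⁺ (v∈A , v∈B))))
    ... | yes v∈A | no  v∉B = x∈p∪q⁺ (inj₁ (x∈p∪q⁺ (inj₁ (ᴬ.∈Y′⁺ v∈Y v∈A v∉B))))
    ... | no  v∉A | yes v∈B = x∈p∪q⁺ (inj₁ (x∈p∪q⁺ (inj₂ (ᴮ.∈Y′⁺ v∈Y v∈B v∉A))))
    ... | no  v∉A | no  v∉B = ⊥-elim (let (_ , covers , _) = sep in Sum.[ v∉A , v∉B ] (covers v))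

  ∣S∣+∣X∩A∩B∣≤2 : ∣ ᴬ.S ∣ + ∣ X ∩ verts A ∩ verts B ∣ ≤ 2
  ∣S∣+∣X∩A∩B∣≤2 = ℕ.≤-trans (∣p∣+∣q∣≤∣r∣+∣s∣ ∪⊆A∩B ∩⊆⊥) (ℕ.≤-reflexive (cong₂ _+_ ᴬ.∣A∩B∣≡2 (∣⊥∣≡0 n)))
    where
    ∪⊆A∩B : ᴬ.S ∪ X ∩ verts A ∩ verts B ⊆ verts A ∩ verts B
    ∪⊆A∩B v∈ with x∈p∪q⁻ ᴬ.S _ v∈
    ... | inj₁ v∈S     = proj₂ (x∈p∩q⁻ Y _ v∈S)
    ... | inj₂ v∈X∩A∩B = proj₂ (x∈p∩q⁻ X _ v∈X∩A∩B)
    ∩⊆⊥ : ᴬ.S ∩ X ∩ verts A ∩ verts B ⊆ ⊥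
    ∩⊆⊥ v∈ = let (v∈S , v∈X∩A∩B) = x∈p∩q⁻ ᴬ.S _ v∈ in
      ⊥-elim (∈X⇒∉Y (proj₁ (x∈p∩q⁻ X _ v∈X∩A∩B)) (proj₁ (x∈p∩q⁻ Y _ v∈S)))

k+3≤2*[k+4]/2 : ∀ k → k ℤ.+ + 3 ℤ.≤ + 2 ℤ.* ((k ℤ.+ + 4) /ℕ 2)
k+3≤2*[k+4]/2 k = begin
  k ℤ.+ + 3                               ≡⟨ shift k ⟩
  k ℤ.+ + 4 ℤ.- + 1                       ≡⟨ cong (ℤ._- + 1) (a≡a%ℕn+[a/ℕn]*n (k ℤ.+ + 4) 2) ⟩
  + r ℤ.+ f ℤ.* + 2 ℤ.- + 1               ≤⟨ ℤ.+-monoˡ-≤ (ℤ.- + 1) (ℤ.+-monoˡ-≤ (f ℤ.* + 2) (ℤ.+≤+ r≤1)) ⟩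
  + 1 ℤ.+ f ℤ.* + 2 ℤ.- + 1               ≡⟨ unshift f ⟩
  + 2 ℤ.* f                               ∎
  where
  open ℤ.≤-Reasoning
  f = (k ℤ.+ + 4) /ℕ 2
  r = (k ℤ.+ + 4) %ℕ 2
  r≤1 : r ≤ 1
  r≤1 = ℕ.≤-pred (n%ℕd<d (k ℤ.+ + 4) 2)
  shift : ∀ k → k ℤ.+ + 3 ≡ k ℤ.+ + 4 ℤ.- + 1
  shift = solve-∀
  unshift : ∀ f → + 1 ℤ.+ f ℤ.* + 2 ℤ.- + 1 ≡ + 2 ℤ.* f
  unshift = solve-∀

averagingℤ : ∀ (k f x y a b t yᴬ yᴮ s : ℤ) → k ℤ.+ + 3 ℤ.≤ + 2 ℤ.* f →
  a ℤ.+ b ℤ.≤ x ℤ.+ t → y ℤ.≤ yᴬ ℤ.+ yᴮ ℤ.+ s → t ℤ.≤ + 2 → s ℤ.+ t ℤ.≤ + 2 → + 2 ℤ.* x ℤ.- k ℤ.≤ y →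
  + 2 ℤ.* a ℤ.- f ℤ.≤ yᴬ ⊎ + 2 ℤ.* b ℤ.- f ℤ.≤ yᴮ
averagingℤ k f x y a b t yᴬ yᴮ s k+3≤2f a+b≤x+t y≤yᴬ+yᴮ+s t≤2 s+t≤2 dense
  with + 2 ℤ.* a ℤ.- f ℤ.≤? yᴬ | + 2 ℤ.* b ℤ.- f ℤ.≤? yᴮ
... | yes denseᴬ | _          = inj₁ denseᴬ
... | no  _      | yes denseᴮ = inj₂ denseᴮ
... | no sparseᴬ | no sparseᴮ = ⊥-elim (ℤ.≤⇒≯ y+2≤y+1 (ℤ.+-monoʳ-< y (ℤ.+<+ ℕ.≤-refl)))
  where
  open ℤ.≤-Reasoning
  split-2 : ∀ p q r → p ℤ.+ q ℤ.+ r ℤ.+ + 2 ≡ (+ 1 ℤ.+ p) ℤ.+ (+ 1 ℤ.+ q) ℤ.+ r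
  split-2 = solve-∀
  collect-f : ∀ p q f r → (+ 2 ℤ.* p ℤ.- f) ℤ.+ (+ 2 ℤ.* q ℤ.- f) ℤ.+ r ≡ + 2 ℤ.* (p ℤ.+ q) ℤ.- + 2 ℤ.* f ℤ.+ r
  collect-f = solve-∀
  expand-2[x+t] : ∀ p q k r → + 2 ℤ.* (p ℤ.+ q) ℤ.- (k ℤ.+ + 3) ℤ.+ r ≡ (+ 2 ℤ.* p ℤ.- k) ℤ.+ (q ℤ.+ (r ℤ.+ q)) ℤ.- + 3
  expand-2[x+t] = solve-∀
  cancel-3 : ∀ p → p ℤ.+ (+ 2 ℤ.+ + 2) ℤ.- + 3 ≡ p ℤ.+ + 1
  cancel-3 = solve-∀
  y+2≤y+1 : y ℤ.+ + 2 ℤ.≤ y ℤ.+ + 1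
  y+2≤y+1 = begin
    y ℤ.+ + 2
      ≤⟨ ℤ.+-monoˡ-≤ (+ 2) y≤yᴬ+yᴮ+s ⟩
    yᴬ ℤ.+ yᴮ ℤ.+ s ℤ.+ + 2
      ≡⟨ split-2 yᴬ yᴮ s ⟩
    (+ 1 ℤ.+ yᴬ) ℤ.+ (+ 1 ℤ.+ yᴮ) ℤ.+ s
      ≤⟨ ℤ.+-monoˡ-≤ s (ℤ.+-mono-≤ (ℤ.i<j⇒suc[i]≤j (ℤ.≰⇒> sparseᴬ)) (ℤ.i<j⇒suc[i]≤j (ℤ.≰⇒> sparseᴮ))) ⟩
    (+ 2 ℤ.* a ℤ.- f) ℤ.+ (+ 2 ℤ.* b ℤ.- f) ℤ.+ s
      ≡⟨ collect-f a b f s ⟩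
    + 2 ℤ.* (a ℤ.+ b) ℤ.- + 2 ℤ.* f ℤ.+ s
      ≤⟨ ℤ.+-monoˡ-≤ s (ℤ.+-mono-≤ (ℤ.*-monoˡ-≤-nonNeg (+ 2) a+b≤x+t) (ℤ.neg-mono-≤ k+3≤2f)) ⟩
    + 2 ℤ.* (x ℤ.+ t) ℤ.- (k ℤ.+ + 3) ℤ.+ s
      ≡⟨ expand-2[x+t] x t k s ⟩
    (+ 2 ℤ.* x ℤ.- k) ℤ.+ (t ℤ.+ (s ℤ.+ t)) ℤ.- + 3
      ≤⟨ ℤ.+-monoˡ-≤ (ℤ.- + 3) (ℤ.+-monoʳ-≤ (+ 2 ℤ.* x ℤ.- k) (ℤ.+-mono-≤ t≤2 s+t≤2)) ⟩
    (+ 2 ℤ.* x ℤ.- k) ℤ.+ (+ 2 ℤ.+ + 2) ℤ.- + 3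
      ≡⟨ cancel-3 (+ 2 ℤ.* x ℤ.- k) ⟩
    (+ 2 ℤ.* x ℤ.- k) ℤ.+ + 1
      ≤⟨ ℤ.+-monoˡ-≤ (+ 1) dense ⟩
    y ℤ.+ + 1 ∎

averaging : ∀ (k : ℤ) (x y a b t yᴬ yᴮ s : ℕ) →
  a + b ≤ x + t → y ≤ yᴬ + yᴮ + s → s + t ≤ 2 → (+ y) ℤ.≥ (+ 2) ℤ.* (+ x) ℤ.- k →
  (+ yᴬ) ℤ.≥ (+ 2) ℤ.* (+ a) ℤ.- (k ℤ.+ + 4) /ℕ 2 ⊎ (+ yᴮ) ℤ.≥ (+ 2) ℤ.* (+ b) ℤ.- (k ℤ.+ + 4) /ℕ 2
averaging k x y a b t yᴬ yᴮ s a+b≤x+t y≤yᴬ+yᴮ+s s+t≤2 =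
  averagingℤ k ((k ℤ.+ + 4) /ℕ 2) (+ x) (+ y) (+ a) (+ b) (+ t) (+ yᴬ) (+ yᴮ) (+ s)
    (k+3≤2*[k+4]/2 k)
    (≡.subst₂ ℤ._≤_ (ℤ.pos-+ a b) (ℤ.pos-+ x t) (ℤ.+≤+ a+b≤x+t))
    (subst (+ y ℤ.≤_) (≡.trans (ℤ.pos-+ (yᴬ + yᴮ) s) (cong (ℤ._+ + s) (ℤ.pos-+ yᴬ yᴮ))) (ℤ.+≤+ y≤yᴬ+yᴮ+s))
    (ℤ.+≤+ (ℕ.≤-trans (ℕ.m≤n+m t s) s+t≤2))
    (subst (ℤ._≤ + 2) (ℤ.pos-+ s t) (ℤ.+≤+ s+t≤2))

lemma3p1 : {n : ℕ} (k : ℤ) (G : Graph n) (X Y : Subset n) →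
    IsBipartition G X Y →
    (+ ∣ Y ∣) ℤ.≥ ((+ 2) ℤ.* (+ ∣ X ∣) ℤ.- k) →
    (∀ y → y ∈ Y → 3 ≤ deg G y) →
    (A B : Subgraph G) → IsTwoSeparation G A B →
    GoodSide G X Y k A (Y ∩ verts A ∩ verts B) ⊎ GoodSide G X Y k B (Y ∩ verts A ∩ verts B)
lemma3p1 k G X Y bip dense deg≥3 A B sep =
  Sum.map (ᴬ.goodSide deg≥3 k) (subst (GoodSide G X Y k B) Sᴮ≡Sᴬ ∘ ᴮ.goodSide deg≥3 k)
    (averaging k (∣ X ∣) (∣ Y ∣) (∣ ᴬ.X′ ∣) (∣ ᴮ.X′ ∣) (∣ X ∩ verts A ∩ verts B ∣) (∣ ᴬ.Y′ ∣) (∣ ᴮ.Y′ ∣) (∣ ᴬ.S ∣)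
      ∣X′ᴬ∣+∣X′ᴮ∣≤∣X∣+∣X∩A∩B∣ ∣Y∣≤∣Y′ᴬ∣+∣Y′ᴮ∣+∣S∣ ∣S∣+∣X∩A∩B∣≤2 dense)
  where
  open BothSides {G = G} bip {A} {B} sep
  Sᴮ≡Sᴬ : ᴮ.S ≡ ᴬ.S
  Sᴮ≡Sᴬ = cong (Y ∩_) (∩-comm (verts B) (verts A))
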